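{- The anchor width of an interval graph on $n$ vertices is at most $n^2$.
   Context: All graphs are finite, simple and undirected. An interval graph is the intersection graph of a finite family of intervals on a line (equivalently, of subpaths of a path). For a graph $G=(V,E)$ and $W\subseteq V$ let $N_G^{\cap}(W)=\bigcap_{w\in W}N_G(w)$ (with $N_G^{\cap}(\emptyset)=V$) and $N_G^{\cup}(W)=\bigcup_{w\in W}N_G(w)$, where $N_G(w)$ is the set of neighbors of $w$. For a clique $C$, the periphery is $P_G(C)=N_G^{\cup}(C)\setminus C$; for $M\subseteq P_G(C)$ the anchor set is $A_G(M,C)=N_G^{\cap}(M)\cap C$ when non-empty; $\mathcal{A}_G(C)=\{A\subseteq C\mid A\neq\emptyset,\ \exists M\subseteq P_G(C): A=A_G(M,C)\}$. The anchor width of $G$ is the smallest $k$ such that $|\mathcal{A}_G(C)|\le k$ for every clique $C$ of $G$. -}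

module Defs where

open import Level using (0ℓ)
open import Data.Nat using (ℕ; _≤_)
open import Data.Fin using (Fin)
open import Data.Fin.Subset using (Subset; _∈_; _∉_)
open import Data.List using (List; length)
open import Data.List.Relation.Unary.All using (All)
open import Data.List.Relation.Unary.Unique.Propositional using (Unique)
open import Data.Product using (Σ; ∃; ∃-syntax; _×_)
open import Function.Bundles using (_⇔_)
open import Relation.Binary.PropositionalEquality using (_≡_; _≢_)
open import Relation.Nullary using (¬_)

record Graph (n : ℕ) : Set₁ where
  field
    E       : Fin n → Fin n → Set
    sym     : ∀ {u v} → E u v → E v u
    irrefl  : ∀ {v} → ¬ E v v

module _ {n : ℕ} (G : Graph n) where
  open Graph G

  InN : Fin n → Fin n → Set
  InN w v = E w v

  IsClique : Subset n → Set
  IsClique C = ∀ u v → u ∈ C → v ∈ C → u ≢ v → E u v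

  InPeriphery : Subset n → Fin n → Set
  InPeriphery C v = (∃[ c ] (c ∈ C × InN c v)) × v ∉ C

  -- A_G(M,C) = N^∩(M) ∩ C, as a predicate on vertices (N^∩(∅) = V)
  InAnchor : Subset n → Subset n → Fin n → Set
  InAnchor M C v = (∀ m → m ∈ M → InN m v) × v ∈ C

  IsAnchorSet : Subset n → Subset n → Set
  IsAnchorSet C A =
    (∃[ a ] a ∈ A) ×
    (∃[ M ] ((∀ m → m ∈ M → InPeriphery C m) × (∀ v → (v ∈ A) ⇔ InAnchor M C v)))

  -- |𝒜_G(C)| ≤ k : every duplicate-free list of members of 𝒜_G(C) has length ≤ k.
  CardAnchorSets≤ : Subset n → ℕ → Set
  CardAnchorSets≤ C k =
    (L : List (Subset n)) → Unique L → All (IsAnchorSet C) L → length L ≤ k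

  AnchorWidth≤ : ℕ → Set
  AnchorWidth≤ k = (C : Subset n) → IsClique C → CardAnchorSets≤ C k

  -- G is an interval graph: closed intervals [l v, r v] (integer endpoints
  -- suffice for finite families) such that distinct vertices are adjacent
  -- iff their intervals intersect.
  IsIntervalGraph : Set
  IsIntervalGraph =
    Σ (Fin n → ℕ) λ l → Σ (Fin n → ℕ) λ r →
      (∀ v → l v ≤ r v) ×
      (∀ u v → u ≢ v → E u v ⇔ (l u ≤ r v × l v ≤ r u))

-- Let x and y be the members of an anchor set A whose intervals end first and
-- start last.  A peripheral vertex adjacent to all of A meets both intervals,
-- hence meets every interval ending no earlier than x's and starting no later
-- than y's.  So A consists exactly of the clique vertices in that window, and
-- is determined by the pair (x, y): there are at most n² anchor sets.
module Submission where

open import Defs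
open import Level using (Level)
open import Data.Nat using (ℕ; suc; _^_; _+_; _*_; _≤_; _≤?_; z≤n; s≤s)
open import Data.Nat.Properties using (≤-trans; *-identityʳ; module ≤-Reasoning)
open import Data.Bool.Properties using (T-≡)
open import Data.Fin using (Fin)
open import Data.Fin.Subset using (Subset; _∈_)
open import Data.Fin.Subset.Properties using (_∈?_; ⊆-antisym)
open import Data.Vec using (tabulate)
open import Data.Vec.Properties using (lookup∘tabulate; []=⇒lookup; lookup⇒[]=)
open import Data.List using (List; []; _∷_; length; map; _++_; allFin; filter; cartesianProductWith)
open import Data.List.Properties using (length-++; length-map; length-++-sucʳ; length-tabulate)
open import Data.List.Extrema.Nat using (argmin; argmax; argmin-all; argmax-all; f[argmin]≤f[xs]; f[xs]≤f[argmax])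
import Data.List.Membership.Propositional as List
open import Data.List.Membership.Propositional.Properties
  using (∈-++⁺ˡ; ∈-++⁺ʳ; ∈-++⁻; ∈-∃++; ∈-allFin; ∈-filter⁺; ∈-cartesianProductWith⁺)
open import Data.List.Relation.Binary.Subset.Propositional using (_⊆_)
open import Data.List.Relation.Unary.Any using (here; there)
open import Data.List.Relation.Unary.All as All using (All)
open import Data.List.Relation.Unary.All.Properties using (all-filter)
open import Data.List.Relation.Unary.AllPairs using (_∷_)
open import Data.List.Relation.Unary.Unique.Propositional using (Unique)
open import Data.Product using (∃-syntax; ∃₂; _×_; _,_; proj₁; proj₂)
open import Data.Sum using (inj₁; inj₂)
open import Data.Empty using (⊥-elim)
open import Function using (_∘_)
open import Function.Bundles using (_⇔_; mk⇔; Equivalence)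
open import Relation.Binary.PropositionalEquality using (_≡_; _≢_; refl; sym; trans; cong; cong₂; module ≡-Reasoning)
open import Relation.Nullary.Decidable using (isYes; _×-dec_; toWitness; fromWitness)
open import Relation.Unary using (Pred; Decidable)

open Equivalence

private
  variable
    ℓ : Level
    X Y Z : Set

length-cartesianProductWith : (f : X → Y → Z) (xs : List X) (ys : List Y) →
                              length (cartesianProductWith f xs ys) ≡ length xs * length ys
length-cartesianProductWith f []       ys = refl
length-cartesianProductWith f (x ∷ xs) ys = begin
  length (map (f x) ys ++ cartesianProductWith f xs ys)  ≡⟨ length-++ (map (f x) ys) ⟩
  length (map (f x) ys) + length (cartesianProductWith f xs ys)
    ≡⟨ cong₂ _+_ (length-map (f x) ys) (length-cartesianProductWith f xs ys) ⟩
  length ys + length xs * length ys                      ∎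
  where open ≡-Reasoning

Unique-⊆⇒length≤ : {xs ys : List X} → Unique xs → xs ⊆ ys → length xs ≤ length ys
Unique-⊆⇒length≤ {xs = []}     _               _     = z≤n
Unique-⊆⇒length≤ {xs = x ∷ xs} (x∉xs ∷ !xs) xs⊆ys with ∈-∃++ (xs⊆ys (here refl))
... | us , vs , refl = begin
  suc (length xs)          ≤⟨ s≤s (Unique-⊆⇒length≤ !xs xs⊆us++vs) ⟩
  suc (length (us ++ vs))  ≡⟨ sym (length-++-sucʳ us x vs) ⟩
  length (us ++ x ∷ vs)    ∎
  where
    open ≤-Reasoning
    xs⊆us++vs : xs ⊆ us ++ vs
    xs⊆us++vs z∈xs with ∈-++⁻ us (xs⊆ys (there z∈xs))
    ... | inj₁ z∈us         = ∈-++⁺ˡ z∈us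
    ... | inj₂ (here refl)  = ⊥-elim (All.lookup x∉xs z∈xs refl)
    ... | inj₂ (there z∈vs) = ∈-++⁺ʳ us z∈vs

module _ {n : ℕ} where

  subsetOf : {P : Pred (Fin n) ℓ} → Decidable P → Subset n
  subsetOf P? = tabulate (isYes ∘ P?)

  ∈-subsetOf⇔ : {P : Pred (Fin n) ℓ} (P? : Decidable P) {x : Fin n} → x ∈ subsetOf P? ⇔ P x
  ∈-subsetOf⇔ P? {x} = mk⇔
    (λ x∈ → toWitness {a? = P? x} (from T-≡ (trans (sym lookup≡isYes) ([]=⇒lookup x∈))))
    (λ px → lookup⇒[]= x _ (trans lookup≡isYes (to T-≡ (fromWitness {a? = P? x} px))))
    where lookup≡isYes = lookup∘tabulate (isYes ∘ P?) x

  module _ (f : Fin n → ℕ) {S : Subset n} {a : Fin n} (a∈S : a ∈ S) where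
    private
      members : List (Fin n)
      members = filter (_∈? S) (allFin n)

      ∈-members : ∀ {c} → c ∈ S → c List.∈ members
      ∈-members c∈S = ∈-filter⁺ (_∈? S) (∈-allFin _) c∈S

    ∃-minimiser : ∃[ x ] x ∈ S × (∀ {c} → c ∈ S → f x ≤ f c)
    ∃-minimiser = argmin f a members
                , argmin-all f a∈S (all-filter (_∈? S) (allFin n))
                , All.lookup (f[argmin]≤f[xs] a members) ∘ ∈-members

    ∃-maximiser : ∃[ y ] y ∈ S × (∀ {c} → c ∈ S → f c ≤ f y)
    ∃-maximiser = argmax f a members
                , argmax-all f a∈S (all-filter (_∈? S) (allFin n))
                , All.lookup (f[xs]≤f[argmax] a members) ∘ ∈-members

module IntervalModel {n : ℕ} (G : Graph n) (l r : Fin n → ℕ)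
  (adj : ∀ u v → u ≢ v → Graph.E G u v ⇔ (l u ≤ r v × l v ≤ r u)) where

  open Graph G using (E)

  adjacent-between : ∀ {m x y c} → m ≢ x → m ≢ y → m ≢ c →
                     E m x → E m y → r x ≤ r c → l c ≤ l y → E m c
  adjacent-between m≢x m≢y m≢c Emx Emy rx≤rc lc≤ly = from (adj _ _ m≢c)
    ( ≤-trans (proj₁ (to (adj _ _ m≢x) Emx)) rx≤rc
    , ≤-trans lc≤ly (proj₂ (to (adj _ _ m≢y) Emy)) )

  window : Subset n → Fin n → Fin n → Subset n
  window C x y = subsetOf (λ c → c ∈? C ×-dec r x ≤? r c ×-dec l c ≤? l y)

  anchorSet≡window : ∀ {C A} → IsAnchorSet G C A → ∃₂ λ x y → A ≡ window C x y
  anchorSet≡window {C} {A} ((a , a∈A) , M , M⊆P , A⇔anchor)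
    with ∃-minimiser r a∈A | ∃-maximiser l a∈A
  ... | x , x∈A , rx≤ | y , y∈A , ≤ly = x , y , ⊆-antisym A⊆W W⊆A
    where
      M≢C : ∀ {m v} → m ∈ M → v ∈ C → m ≢ v
      M≢C m∈M v∈C refl = proj₂ (M⊆P _ m∈M) v∈C

      A⊆N[M]∩C : ∀ {v} → v ∈ A → (∀ m → m ∈ M → E m v) × v ∈ C
      A⊆N[M]∩C {v} = to (A⇔anchor v)

      A⊆W : ∀ {c} → c ∈ A → c ∈ window C x y
      A⊆W {c} c∈A = from (∈-subsetOf⇔ _) (proj₂ (A⊆N[M]∩C c∈A) , rx≤ c∈A , ≤ly c∈A)

      W⊆A : ∀ {c} → c ∈ window C x y → c ∈ A
      W⊆A {c} c∈W with to (∈-subsetOf⇔ _) c∈W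
      ... | c∈C , rx≤rc , lc≤ly = from (A⇔anchor c) (M⊆N[c] , c∈C)
        where
          M⊆N[c] : ∀ m → m ∈ M → E m c
          M⊆N[c] m m∈M = adjacent-between
            (M≢C m∈M (proj₂ (A⊆N[M]∩C x∈A))) (M≢C m∈M (proj₂ (A⊆N[M]∩C y∈A))) (M≢C m∈M c∈C)
            (proj₁ (A⊆N[M]∩C x∈A) m m∈M) (proj₁ (A⊆N[M]∩C y∈A) m m∈M) rx≤rc lc≤ly

  -- The bound holds for every vertex set C.
  anchorSets≤n² : ∀ C → CardAnchorSets≤ G C (n ^ 2)
  anchorSets≤n² C L !L anchors = begin
    length L                                 ≤⟨ Unique-⊆⇒length≤ !L L⊆windows ⟩
    length windows                           ≡⟨ length-cartesianProductWith (window C) (allFin n) (allFin n) ⟩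
    length (allFin n) * length (allFin n)    ≡⟨ cong₂ _*_ (length-tabulate {n = n} _) (length-tabulate {n = n} _) ⟩
    n * n                                    ≡⟨ cong (n *_) (sym (*-identityʳ n)) ⟩
    n ^ 2                                    ∎
    where
      open ≤-Reasoning
      windows : List (Subset n)
      windows = cartesianProductWith (window C) (allFin n) (allFin n)

      L⊆windows : L ⊆ windows
      L⊆windows A∈L with anchorSet≡window (All.lookup anchors A∈L)
      ... | x , y , refl = ∈-cartesianProductWith⁺ (window C) (∈-allFin x) (∈-allFin y)

corollary14 : (n : ℕ) (G : Graph n) → IsIntervalGraph G → AnchorWidth≤ G (n ^ 2)
corollary14 n G (l , r , _ , adj) C _ = IntervalModel.anchorSets≤n² G l r adj C
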